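{- Let $P=\{p_1,\ldots,p_n\}$ be a point set in general position with distance function $d$, let $G$ be a directed graph on $P$ with out-neighborhoods $N_i$, and let $Q\subset P$ be such that for every $p_i\in Q$, $Q\setminus\{p_i\}\subseteq N_i$. Then for any $p_j\notin Q$, for all but at most one $p_i\in Q$ there exists $p_k\in N_i$ with $p_j\in S_{i\to k}$. Consequently, if for each $i$ we let $U_i$ be the set of $p_j\in P\setminus\{p_i\}$ such that $p_j\notin S_{i\to k}$ for every $p_k\in N_i$, then $$\sum_{p_i\in Q}|U_i|\le n-|Q|.$$
   Context: A distance function on $P$ is any $d:P\times P\to\mathbb{R}_{\ge0}$ with $d(p_i,p_i)=0$ and $d(p_i,p_j)=d(p_j,p_i)>0$ for $i\ne j$. General position: points are distinct and $d(p_i,p_j)\neq d(p_i,p_k)$ for all $i$ and $j\ne k$. For $k\ne i$, $S_{i\to k}=\{p_j\in P\setminus\{p_i\}: d(p_j,p_k)<d(p_j,p_i)\}$. -}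

module Defs where

open import Level using (Level; _⊔_)
open import Data.Nat using (ℕ; _+_)
open import Data.Fin using (Fin)
open import Data.Fin.Properties using (all?) renaming (_≟_ to _≟ᶠ_)
open import Data.Fin.Subset using (Subset; _∈_; _∉_; ∣_∣)
open import Data.Fin.Subset.Properties using (_∈?_)
open import Data.Product using (_×_; ∃-syntax)
open import Data.List using (map; allFin)
open import Data.Nat.ListAction using (sum)
open import Data.Vec using (tabulate)
open import Relation.Nullary using (¬_; Dec; yes; no)
open import Relation.Nullary.Decidable using (⌊_⌋; _×-dec_; ¬?; _→-dec_)
open import Relation.Binary using (StrictTotalOrder)
open import Relation.Binary.PropositionalEquality using (_≡_; _≢_)

-- Distances take values in an arbitrary (decidable) strict total order with a
-- distinguished element 0 (this covers ℝ≥0 ⊆ ℝ); only comparisons matter.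
module _ {a ℓ₁ ℓ₂ : Level} (O : StrictTotalOrder a ℓ₁ ℓ₂) where
  open StrictTotalOrder O renaming (Carrier to D)

  -- d is a distance function on P = {p_0,…,p_{n-1}} (points are indices,
  -- hence distinct): d(p,p) = 0, symmetric, positive off the diagonal.
  record IsDistance {n : ℕ} (zero : D) (d : Fin n → Fin n → D) : Set (a ⊔ ℓ₁ ⊔ ℓ₂) where
    field
      diag : ∀ i → d i i ≈ zero
      symm : ∀ i j → d i j ≈ d j i
      pos  : ∀ i j → i ≢ j → zero < d i j

  GeneralPosition : {n : ℕ} → (Fin n → Fin n → D) → Set (ℓ₁)
  GeneralPosition d = ∀ i j k → j ≢ k → ¬ (d i j ≈ d i k)

  -- p_j ∈ S_{i→k}  (for k ≠ i):  j ≠ i and d(p_j,p_k) < d(p_j,p_i)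
  InS : {n : ℕ} → (Fin n → Fin n → D) → Fin n → Fin n → Fin n → Set ℓ₂
  InS d i k j = j ≢ i × d j k < d j i

  U : {n : ℕ} → (Fin n → Fin n → D) → (Fin n → Subset n) → Fin n → Subset n
  U d N i = tabulate λ j →
    ⌊ ¬? (j ≟ᶠ i) ×-dec all? (λ k → (k ∈? N i) →-dec ¬? (InS? j k)) ⌋
    where
      InS? : ∀ j k → Dec (InS d i k j)
      InS? j k = ¬? (j ≟ᶠ i) ×-dec (d j k <? d j i)

sumOver : {n : ℕ} → Subset n → (Fin n → ℕ) → ℕ
sumOver {n} Q f = sum (map (λ i → g i (i ∈? Q)) (allFin n))
  where
    g : ∀ i → Dec (i ∈ Q) → ℕ
    g i (yes _) = f i
    g i (no _)  = 0

{-# OPTIONS --safe #-}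
-- If p_j lies outside Q and i ≠ i′ are in Q, then i′ ∈ N_i and i ∈ N_i′, and by general
-- position p_j is strictly closer to one of p_i, p_i′ than to the other, so it lies in
-- S_{i→i′} or in S_{i′→i}. Hence the sets U_i (i ∈ Q) are pairwise disjoint. Each of them
-- avoids Q, since p_j ∈ Q ∖ {p_i} lies in S_{i→j} (d(p_j,p_j) = 0). So they are disjoint
-- subsets of P ∖ Q, and their sizes add up to at most n − |Q|.
module Submission where

open import Defs
open import Level using (Level)
open import Data.Nat using (ℕ; _≤_; _∸_; _+_; suc)
open import Data.Nat.Properties using (+-suc)
open import Data.Nat.ListAction using (sum)
open import Data.Fin using (Fin; zero)
open import Data.Fin.Properties using () renaming (_≟_ to _≟ᶠ_)
open import Data.Fin.Subset
  using (Subset; _∈_; _∉_; _⊆_; ∣_∣; _∪_; _∩_; ⊥; ∁; ⋃; Empty; inside; outside)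
open import Data.Fin.Subset.Properties
  using ( _∈?_; ∉⊥; x∈p∪q⁻; x∈p∩q⁺; x∈p∩q⁻; x∉p⇒x∈∁p; x∈∁p⇒x∉p; drop-∷-Empty
        ; ∣⊥∣≡0; ∣∁p∣≡n∸∣p∣; p⊆q⇒∣p∣≤∣q∣ )
open import Data.Vec using (_∷_; []; here)
open import Data.Vec.Properties using (lookup∘tabulate; []=⇒lookup)
open import Data.List using (List; map; allFin) renaming ([] to []ˡ; _∷_ to _∷ˡ_)
open import Data.List.Properties using (map-cong; map-∘)
open import Data.List.Relation.Unary.Any using (Any; here; there)
open import Data.List.Relation.Unary.All as All using (All; lookupWith; universal)
import Data.List.Relation.Unary.All.Properties as All
open import Data.List.Relation.Unary.AllPairs as AllPairs using (AllPairs; _∷_; [])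
import Data.List.Relation.Unary.AllPairs.Properties as AllPairs
open import Data.List.Relation.Unary.Unique.Propositional.Properties using (allFin⁺)
open import Data.Bool.Properties using (T-≡)
open import Data.Product using (_×_; _,_; ∃-syntax; proj₁; proj₂)
open import Data.Sum using (_⊎_; inj₁; inj₂; [_,_]′)
open import Function using (Equivalence; _∘_)
open import Relation.Nullary using (¬_; yes; no; contradiction)
open import Relation.Nullary.Decidable using (toWitness)
open import Relation.Binary using (StrictTotalOrder; tri<; tri≈; tri>)
open import Relation.Binary.PropositionalEquality
  using (_≡_; _≢_; _≗_; refl; sym; trans; cong; subst; module ≡-Reasoning)

Disjoint : ∀ {n} → Subset n → Subset n → Set
Disjoint p q = Empty (p ∩ q)

∣p∪q∣≡∣p∣+∣q∣ : ∀ {n} (p q : Subset n) → Disjoint p q → ∣ p ∪ q ∣ ≡ ∣ p ∣ + ∣ q ∣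
∣p∪q∣≡∣p∣+∣q∣ []            []            _   = refl
∣p∪q∣≡∣p∣+∣q∣ (inside  ∷ p) (inside  ∷ q) p#q = contradiction (zero , here) p#q
∣p∪q∣≡∣p∣+∣q∣ (inside  ∷ p) (outside ∷ q) p#q =
  cong suc (∣p∪q∣≡∣p∣+∣q∣ p q (drop-∷-Empty p#q))
∣p∪q∣≡∣p∣+∣q∣ (outside ∷ p) (inside  ∷ q) p#q =
  trans (cong suc (∣p∪q∣≡∣p∣+∣q∣ p q (drop-∷-Empty p#q))) (sym (+-suc ∣ p ∣ ∣ q ∣))
∣p∪q∣≡∣p∣+∣q∣ (outside ∷ p) (outside ∷ q) p#q = ∣p∪q∣≡∣p∣+∣q∣ p q (drop-∷-Empty p#q)

module _ {n : ℕ} where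

  ∉⇒≢ : ∀ {p : Subset n} {x y} → y ∉ p → x ∈ p → y ≢ x
  ∉⇒≢ y∉p x∈p refl = y∉p x∈p

  x∈⋃⁻ : ∀ {x} (ps : List (Subset n)) → x ∈ ⋃ ps → Any (x ∈_) ps
  x∈⋃⁻ []ˡ        x∈⋃ = contradiction x∈⋃ ∉⊥
  x∈⋃⁻ (p ∷ˡ ps) x∈⋃ = [ here , (λ x∈⋃ps → there (x∈⋃⁻ ps x∈⋃ps)) ]′ (x∈p∪q⁻ p (⋃ ps) x∈⋃)

  ⋃⊆ : ∀ {r : Subset n} {ps} → All (_⊆ r) ps → ⋃ ps ⊆ r
  ⋃⊆ {ps = ps} ps⊆r x∈⋃ = lookupWith (λ p⊆r x∈p → p⊆r x∈p) ps⊆r (x∈⋃⁻ ps x∈⋃)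

  Disjoint-⋃ : ∀ {p : Subset n} {qs} → All (Disjoint p) qs → Disjoint p (⋃ qs)
  Disjoint-⋃ {p} {qs} p#qs (x , x∈p∩⋃) with x∈p∩q⁻ p (⋃ qs) x∈p∩⋃
  ... | x∈p , x∈⋃ = lookupWith (λ p#q x∈q → p#q (x , x∈p∩q⁺ (x∈p , x∈q))) p#qs (x∈⋃⁻ qs x∈⋃)

  ∣⋃∣≡sum : (ps : List (Subset n)) → AllPairs Disjoint ps → ∣ ⋃ ps ∣ ≡ sum (map ∣_∣ ps)
  ∣⋃∣≡sum []ˡ        []           = ∣⊥∣≡0 n
  ∣⋃∣≡sum (p ∷ˡ ps) (p#ps ∷ ps#) =
    trans (∣p∪q∣≡∣p∣+∣q∣ p (⋃ ps) (Disjoint-⋃ p#ps)) (cong (∣ p ∣ +_) (∣⋃∣≡sum ps ps#))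

  -- The summand of sumOver is local to its definition, so it is exposed through this witness.
  sumOver-unfold : (Q : Subset n) (f : Fin n → ℕ) → ∃[ h ] sumOver Q f ≡ sum (map h (allFin n))
  sumOver-unfold Q f = _ , refl

  sumOver≡sum : (Q : Subset n) (f g : Fin n → ℕ) →
    (∀ i → i ∈ Q → f i ≡ g i) → (∀ i → i ∉ Q → 0 ≡ g i) →
    sumOver Q f ≡ sum (map g (allFin n))
  sumOver≡sum Q f g f≡g 0≡g = cong sum (map-cong summand≗g (allFin n))
    where
    summand : Fin n → ℕ
    summand = proj₁ (sumOver-unfold Q f)

    summand≗g : summand ≗ g
    summand≗g i with i ∈? Q
    ... | yes i∈Q = f≡g i i∈Q
    ... | no  i∉Q = 0≡g i i∉Q

  sumOver-disjoint-≤ : (Q R : Subset n) (V : Fin n → Subset n) →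
    (∀ {i} → i ∈ Q → V i ⊆ R) →
    (∀ {i i′} → i ∈ Q → i′ ∈ Q → i ≢ i′ → Disjoint (V i) (V i′)) →
    sumOver Q (λ i → ∣ V i ∣) ≤ ∣ R ∣
  sumOver-disjoint-≤ Q R V V⊆R V-disjoint =
    subst (_≤ ∣ R ∣) (sym total≡) (p⊆q⇒∣p∣≤∣q∣ (⋃⊆ (All.map⁺ (universal W⊆R (allFin n)))))
    where
    W : Fin n → Subset n
    W i with i ∈? Q
    ... | yes _ = V i
    ... | no  _ = ⊥

    ∈W⁻ : ∀ i {x} → x ∈ W i → i ∈ Q × x ∈ V i
    ∈W⁻ i x∈W with i ∈? Q
    ... | yes i∈Q = i∈Q , x∈W
    ... | no  _   = contradiction x∈W ∉⊥

    W⊆R : ∀ i → W i ⊆ R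
    W⊆R i x∈W = V⊆R (proj₁ (∈W⁻ i x∈W)) (proj₂ (∈W⁻ i x∈W))

    W-disjoint : ∀ {i i′} → i ≢ i′ → Disjoint (W i) (W i′)
    W-disjoint {i} {i′} i≢i′ (x , x∈W∩W′) with x∈p∩q⁻ _ _ x∈W∩W′
    ... | x∈W , x∈W′ with ∈W⁻ i x∈W | ∈W⁻ i′ x∈W′
    ...   | i∈Q , x∈V | i′∈Q , x∈V′ = V-disjoint i∈Q i′∈Q i≢i′ (x , x∈p∩q⁺ (x∈V , x∈V′))

    ∣V∣≡∣W∣ : ∀ i → i ∈ Q → ∣ V i ∣ ≡ ∣ W i ∣
    ∣V∣≡∣W∣ i i∈Q with i ∈? Q
    ... | yes _   = refl
    ... | no  i∉Q = contradiction i∈Q i∉Q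

    0≡∣W∣ : ∀ i → i ∉ Q → 0 ≡ ∣ W i ∣
    0≡∣W∣ i i∉Q with i ∈? Q
    ... | yes i∈Q = contradiction i∈Q i∉Q
    ... | no  _   = sym (∣⊥∣≡0 n)

    total≡ : sumOver Q (λ i → ∣ V i ∣) ≡ ∣ ⋃ (map W (allFin n)) ∣
    total≡ = begin
      sumOver Q (λ i → ∣ V i ∣)               ≡⟨ sumOver≡sum Q _ _ ∣V∣≡∣W∣ 0≡∣W∣ ⟩
      sum (map (λ i → ∣ W i ∣) (allFin n))     ≡⟨ cong sum (map-∘ (allFin n)) ⟩
      sum (map ∣_∣ (map W (allFin n)))          ≡⟨ sym (∣⋃∣≡sum _ W-pairwise) ⟩
      ∣ ⋃ (map W (allFin n)) ∣                 ∎
      where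
      open ≡-Reasoning
      W-pairwise : AllPairs Disjoint (map W (allFin n))
      W-pairwise = AllPairs.map⁺ (AllPairs.map W-disjoint (allFin⁺ n))

Clique : ∀ {n} → (Fin n → Subset n) → Subset n → Set
Clique N Q = ∀ i → i ∈ Q → ∀ j → j ∈ Q → j ≢ i → j ∈ N i

module _ {a ℓ₁ ℓ₂ : Level} (O : StrictTotalOrder a ℓ₁ ℓ₂) where
  open StrictTotalOrder O using (compare; <-respˡ-≈; module Eq) renaming (Carrier to D)

  module _ {n : ℕ} {d : Fin n → Fin n → D} where

    InS-self : ∀ {z} → IsDistance O z d → ∀ {i j} → j ≢ i → InS O d i j j
    InS-self isDistance {i} {j} j≢i =
      j≢i , <-respˡ-≈ (Eq.sym (IsDistance.diag isDistance j)) (IsDistance.pos isDistance j i j≢i)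

    InS-either : GeneralPosition O d → ∀ {i i′ j} → i ≢ i′ → j ≢ i → j ≢ i′ →
      InS O d i′ i j ⊎ InS O d i i′ j
    InS-either genPos {i} {i′} {j} i≢i′ j≢i j≢i′ with compare (d j i) (d j i′)
    ... | tri< closer-to-i _ _ = inj₁ (j≢i′ , closer-to-i)
    ... | tri≈ _ equidistant _ = contradiction equidistant (genPos j i i′ i≢i′)
    ... | tri> _ _ closer-to-i′ = inj₂ (j≢i , closer-to-i′)

    ∉S-unique : GeneralPosition O d → (N : Fin n → Subset n) (Q : Subset n) → Clique N Q →
      ∀ {j} → j ∉ Q → ∀ {i i′} → i ∈ Q → i′ ∈ Q →
      ¬ (∃[ k ] (k ∈ N i × InS O d i k j)) →
      ¬ (∃[ k ] (k ∈ N i′ × InS O d i′ k j)) →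
      i ≡ i′
    ∉S-unique genPos N Q clique j∉Q {i} {i′} i∈Q i′∈Q ∉S ∉S′ with i ≟ᶠ i′
    ... | yes i≡i′ = i≡i′
    ... | no  i≢i′ with InS-either genPos i≢i′ (∉⇒≢ j∉Q i∈Q) (∉⇒≢ j∉Q i′∈Q)
    ...   | inj₁ j∈S′ = contradiction (i , clique i′ i′∈Q i i∈Q i≢i′ , j∈S′) ∉S′
    ...   | inj₂ j∈S  = contradiction (i′ , clique i i∈Q i′ i′∈Q (i≢i′ ∘ sym) , j∈S) ∉S

    ∈U⁻ : (N : Fin n → Subset n) → ∀ {i j} → j ∈ U O d N i →
      j ≢ i × ¬ (∃[ k ] (k ∈ N i × InS O d i k j))
    ∈U⁻ N {i} {j} j∈U = proj₁ unfolded , λ (k , k∈N , j∈S) → proj₂ unfolded k k∈N j∈S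
      where
      unfolded : j ≢ i × (∀ k → k ∈ N i → ¬ InS O d i k j)
      unfolded =
        toWitness (Equivalence.from T-≡ (trans (sym (lookup∘tabulate _ j)) ([]=⇒lookup j∈U)))

    U⊆∁Q : ∀ {z} → IsDistance O z d → (N : Fin n → Subset n) (Q : Subset n) → Clique N Q →
      ∀ {i} → i ∈ Q → U O d N i ⊆ ∁ Q
    U⊆∁Q isDistance N Q clique {i} i∈Q {j} j∈U with ∈U⁻ N j∈U
    ... | j≢i , ∉S = x∉p⇒x∈∁p λ j∈Q → ∉S (j , clique i i∈Q j j∈Q j≢i , InS-self isDistance j≢i)

    U-disjoint : ∀ {z} → IsDistance O z d → GeneralPosition O d →
      (N : Fin n → Subset n) (Q : Subset n) → Clique N Q →
      ∀ {i i′} → i ∈ Q → i′ ∈ Q → i ≢ i′ → Disjoint (U O d N i) (U O d N i′)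
    U-disjoint isDistance genPos N Q clique i∈Q i′∈Q i≢i′ (j , j∈U∩U′)
      with x∈p∩q⁻ _ _ j∈U∩U′
    ... | j∈U , j∈U′ =
      i≢i′ (∉S-unique genPos N Q clique j∉Q i∈Q i′∈Q (proj₂ (∈U⁻ N j∈U)) (proj₂ (∈U⁻ N j∈U′)))
      where
      j∉Q : j ∉ Q
      j∉Q = x∈∁p⇒x∉p (U⊆∁Q isDistance N Q clique i∈Q j∈U)

claim3p5 : {a ℓ₁ ℓ₂ : Level} (O : StrictTotalOrder a ℓ₁ ℓ₂) →
    let open StrictTotalOrder O renaming (Carrier to D) in
    (n : ℕ) (zero : D) (d : Fin n → Fin n → D) →
    IsDistance O zero d → GeneralPosition O d →
    (N : Fin n → Subset n) (Q : Subset n) →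
    (∀ i → i ∈ Q → ∀ j → j ∈ Q → j ≢ i → j ∈ N i) →
    ((j : Fin n) → j ∉ Q → (i i′ : Fin n) → i ∈ Q → i′ ∈ Q →
        ¬ (∃[ k ] (k ∈ N i × InS O d i k j)) →
        ¬ (∃[ k ] (k ∈ N i′ × InS O d i′ k j)) →
        i ≡ i′)
    × (sumOver Q (λ i → ∣ U O d N i ∣) ≤ n ∸ ∣ Q ∣)
claim3p5 O n _ d isDistance genPos N Q clique =
    (λ j j∉Q i i′ → ∉S-unique O genPos N Q clique j∉Q)
  , subst (sumOver Q (λ i → ∣ U O d N i ∣) ≤_) (∣∁p∣≡n∸∣p∣ Q)
      (sumOver-disjoint-≤ Q (∁ Q) (U O d N)
        (U⊆∁Q O isDistance N Q clique) (U-disjoint O isDistance genPos N Q clique))
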